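{- For every $m\in\mathbb{N}$ there is a constant $c=c(m)$ such that for every $n\ge1$ the number of $m$-tame black-white colorings $(n,\chi)$ is at most $n^c$.
   Context: A black-white coloring is $(n,\chi)$ with $\chi:\binom{[n]}{2}\to\{\text{black},\text{white}\}$. A set $A$ is $\chi$-monochromatic if $\chi$ is constant on $\binom{A}{2}$. For subsets $I=\{x_1<\dots<x_r\}$ and $J=\{y_1<\dots<y_s\}$ of $[n]$ with $I<J$ (all elements of $I$ below all of $J$), $M_{I,J}$ is the $r\times s$ 0-1 matrix with $M_{I,J}(i,j)=0$ iff $\chi(\{x_i,y_j\})=\text{white}$. For a 0-1 matrix $M$, $al(M)$ is the maximum, over all rows and columns, of the number of maximal intervals of consecutive equal entries; for an $r\times s$ matrix $C(M)=\bigcup_{j}\{a\in[r-1]:M(a,j)\ne M(a+1,j)\}$. $(n,\chi)$ is $m$-tame if: (1) there is a partition of $[n]$ into intervals $I_1<\dots<I_s$ with $s\le m$, each $\chi$-monochromatic; (2) $al(M_{I,J})\le m$ for all intervals $I<J$ in $[n]$; (3) $|C(M_{I,J})|\le m$ for all intervals $I<J$ in $[n]$. -}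

module Defs where

open import Data.Nat using (ℕ; zero; suc; _+_; _∸_; _≤_; _<_)
open import Data.Bool using (Bool; true; false; if_then_else_; _xor_; _∨_)
open import Data.List using (List; []; _∷_; length)
open import Data.Nat.ListAction using (sum)
open import Data.Unit using (⊤)
open import Data.Product using (_×_; Σ)
open import Relation.Binary.PropositionalEquality using (_≡_)

-- A black-white coloring of the pairs of [n] = {1,…,n}.
-- χ x y (for 1 ≤ x < y ≤ n) is the colour of the pair {x,y}:
-- false = white (matrix entry 0), true = black (matrix entry 1).
-- Values of χ outside {x < y, both in [n]} are irrelevant; two colorings
-- are the same coloring iff they agree on all pairs (see SameColoring).
Coloring : Set
Coloring = ℕ → ℕ → Bool

SameColoring : ℕ → Coloring → Coloring → Set
SameColoring n χ χ' = ∀ x y → 1 ≤ x → x < y → y ≤ n → χ x y ≡ χ' x y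

countFrom : (ℕ → Bool) → ℕ → ℕ → ℕ
countFrom p a zero = 0
countFrom p a (suc l) = (if p a then 1 else 0) + countFrom p (suc a) l

anyFrom : (ℕ → Bool) → ℕ → ℕ → Bool
anyFrom p a zero = false
anyFrom p a (suc l) = p a ∨ anyFrom p (suc a) l

Monochromatic : Coloring → ℕ → ℕ → Set
Monochromatic χ a b =
  ∀ x y x' y' → a ≤ x → x < y → y ≤ b → a ≤ x' → x' < y' → y' ≤ b →
  χ x y ≡ χ x' y'

-- A list of block lengths (l₁,…,l_s) describes the partition of
-- {start, …} into consecutive nonempty intervals
-- I₁ = {start,…,start+l₁-1}, I₂ = {start+l₁,…}, …;  each must be monochromatic.
MonoBlocks : Coloring → ℕ → List ℕ → Set
MonoBlocks χ start [] = ⊤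
MonoBlocks χ start (l ∷ ls) =
  (1 ≤ l) × Monochromatic χ start (start + l ∸ 1) × MonoBlocks χ (start + l) ls

Cond1 : ℕ → ℕ → Coloring → Set
Cond1 m n χ = Σ (List ℕ) λ ls →
  (sum ls ≡ n) × (length ls ≤ m) × MonoBlocks χ 1 ls

IsInterval : ℕ → ℕ → ℕ → Set
IsInterval n a b = (1 ≤ a) × (a ≤ b) × (b ≤ n)

-- For I = {a,…,b} < J = {c,…,d} (b < c), M_{I,J}(i,j) = χ (a+i-1) (c+j-1).
-- Number of maximal runs of row x (x ∈ I) of M_{I,J}: 1 + number of changes.
rowRuns : Coloring → ℕ → ℕ → ℕ → ℕ
rowRuns χ c d x = suc (countFrom (λ y → χ x y xor χ x (suc y)) c (d ∸ c))

colRuns : Coloring → ℕ → ℕ → ℕ → ℕ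
colRuns χ a b y = suc (countFrom (λ x → χ x y xor χ (suc x) y) a (b ∸ a))

AlBound : ℕ → Coloring → ℕ → ℕ → ℕ → ℕ → Set
AlBound m χ a b c d =
  (∀ x → a ≤ x → x ≤ b → rowRuns χ c d x ≤ m) ×
  (∀ y → c ≤ y → y ≤ d → colRuns χ a b y ≤ m)

-- |C(M_{I,J})| : number of row indices i ∈ [r-1] such that rows i and i+1
-- differ in some column, i.e. x ∈ {a,…,b-1} with χ x y ≠ χ (x+1) y
-- for some y ∈ {c,…,d}.
sizeC : Coloring → ℕ → ℕ → ℕ → ℕ → ℕ
sizeC χ a b c d =
  countFrom (λ x → anyFrom (λ y → χ x y xor χ (suc x) y) c (suc (d ∸ c)))
            a (b ∸ a)

Tame : ℕ → ℕ → Coloring → Set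
Tame m n χ =
  Cond1 m n χ ×
  (∀ a b c d → IsInterval n a b → IsInterval n c d → b < c →
     AlBound m χ a b c d) ×
  (∀ a b c d → IsInterval n a b → IsInterval n c d → b < c →
     sizeC χ a b c d ≤ m)

{-# OPTIONS --safe #-}
-- A tame coloring is determined by boundedly many numbers in [0, n] and boundedly
-- many colours.  By condition (1), x ↦ (block containing x) is a step function with at
-- most m steps.  Inside a block [s, e] all pairs have one colour, and on the columns
-- (e, n] condition (3) for M_{[s,e],(e,n]} makes the rows x ∈ [s, e] a step function
-- of x with at most m steps, while condition (2) makes each such row a step function
-- of y with at most m steps.  Hence a tame coloring is decoded from a word of length
-- K(m) over an alphabet of size n + 1, so there are at most (n + 1)^K ≤ n^(2K) of them
-- for n ≥ 2; for n = 1 there are no pairs to colour.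
module Submission where

open import Defs
open import Data.Bool using (Bool; true; false; if_then_else_; _xor_)
open import Data.Bool.Properties using (∨-conicalˡ; ∨-conicalʳ)
open import Data.Empty using (⊥-elim)
open import Data.Fin using (Fin; toℕ; fromℕ<; combine; remQuot; punchIn; punchOut)
  renaming (zero to fzero; suc to fsuc)
open import Data.Fin.Properties using (toℕ-fromℕ<; remQuot-combine; punchIn-punchOut)
open import Data.List using (List; []; _∷_; length)
open import Data.List.Relation.Unary.All using (All; []; _∷_)
import Data.List.Relation.Unary.All as All
open import Data.List.Relation.Unary.AllPairs using (AllPairs; []; _∷_)
open import Data.Nat
  using (ℕ; zero; suc; _+_; _*_; _∸_; _^_; _≤_; _<_; z≤n; s≤s; z<s; _≤?_; _<?_)
open import Data.Nat.ListAction using (sum)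
open import Data.Nat.Properties
open import Data.Product using (Σ; _×_; _,_; proj₁; proj₂; ∃; ∃-syntax; uncurry)
import Data.Product as Product
open import Data.Sum using (inj₁; inj₂)
open import Data.Vec using (Vec; []; _∷_; replicate)
import Data.Vec.Relation.Unary.All as VAll
open VAll using ([]; _∷_)
open import Function using (_∘_)
open import Relation.Binary.Definitions using (Symmetric; Transitive)
open import Relation.Binary.PropositionalEquality
  using (_≡_; refl; sym; trans; cong; cong₂; subst)
open import Relation.Nullary using (¬_; does; yes; no)
open import Relation.Nullary.Decidable using (dec-true; dec-false)

private
  variable
    A B : Set
    N e e₁ e₂ m : ℕ

xor≡false⇒≡ : ∀ {a b} → a xor b ≡ false → a ≡ b
xor≡false⇒≡ {false} {false} _ = refl
xor≡false⇒≡ {true}  {true}  _ = refl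
xor≡false⇒≡ {false} {true}  ()
xor≡false⇒≡ {true}  {false} ()

anyFrom≡false : ∀ p a l → anyFrom p a l ≡ false →
  ∀ {y} → a ≤ y → y < a + l → p y ≡ false
anyFrom≡false p a zero    _    {y} a≤y y<a+0 =
  ⊥-elim (<⇒≱ (subst (y <_) (+-identityʳ a) y<a+0) a≤y)
anyFrom≡false p a (suc l) none {y} a≤y y<a+l+1 with m≤n⇒m<n∨m≡n a≤y
... | inj₂ refl = ∨-conicalˡ (p a) _ none
... | inj₁ a<y  = anyFrom≡false p (suc a) l (∨-conicalʳ (p a) _ none) a<y
                    (subst (y <_) (+-suc a l) y<a+l+1)

replicate⁺ : ∀ {P : A → Set} {a} m → P a → VAll.All P (replicate m a)
replicate⁺ zero    pa = []
replicate⁺ (suc m) pa = pa ∷ replicate⁺ m pa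

StepCode : ℕ → Set → ℕ → Set
StepCode N A m = Vec (Fin N) m × Vec A (suc m)

upTo : ℕ → A → (ℕ → A) → ℕ → A
upTo e c g y = if does (y ≤? e) then c else g y

eval : StepCode N A m → ℕ → A
eval ([]     , c ∷ [])  = λ _ → c
eval (p ∷ ps , c ∷ cs) = upTo (toℕ p) c (eval (ps , cs))

constant : Fin N → A → StepCode N A m
constant {m = m} p c = replicate m p , replicate (suc m) c

cons : ∀ a → a < N → A → StepCode N A m → StepCode N A (suc m)
cons a a<N c (ps , cs) = fromℕ< a<N ∷ ps , c ∷ cs

upTo-≤ : ∀ {e y} {c : A} {g} → y ≤ e → upTo e c g y ≡ c
upTo-≤ {e = e} {y} y≤e rewrite dec-true (y ≤? e) y≤e = refl

upTo-> : ∀ {e y} {c : A} {g} → e < y → upTo e c g y ≡ g y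
upTo-> {e = e} {y} e<y rewrite dec-false (y ≤? e) (<⇒≱ e<y) = refl

upTo-piecewise : ∀ {Q : ℕ → A → Set} {s e b c g} →
  (∀ x → s ≤ x → x ≤ e → Q x c) → (∀ x → e < x → x ≤ b → Q x (g x)) →
  ∀ x → s ≤ x → x ≤ b → Q x (upTo e c g x)
upTo-piecewise {Q = Q} {e = e} {g = g} before after x s≤x x≤b with x ≤? e
... | yes x≤e = subst (Q x) (sym (upTo-≤ {g = g} x≤e)) (before x s≤x x≤e)
... | no  x≰e = subst (Q x) (sym (upTo-> {g = g} (≰⇒> x≰e))) (after x (≰⇒> x≰e) x≤b)

eval-constant : ∀ m (p : Fin N) (c : A) x → eval (constant {m = m} p c) x ≡ c
eval-constant zero    p c x = refl
eval-constant (suc m) p c x with does (x ≤? toℕ p)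
... | true  = refl
... | false = eval-constant m p c x

eval-cons-piecewise : ∀ {Q : ℕ → A → Set} {a s b} (a<N : a < N) c (f : StepCode N A m) →
  (∀ x → s ≤ x → x ≤ a → Q x c) → (∀ x → a < x → x ≤ b → Q x (eval f x)) →
  ∀ x → s ≤ x → x ≤ b → Q x (eval (cons a a<N c f) x)
eval-cons-piecewise {Q = Q} a<N c (ps , cs) before after x s≤x x≤b =
  subst (λ a → Q x (upTo a c (eval (ps , cs)) x)) (sym (toℕ-fromℕ< a<N))
    (upTo-piecewise {Q = Q} before after x s≤x x≤b)

eval-suc : ∀ {x} (f : StepCode N A m) → VAll.All (λ p → x < toℕ p) (proj₁ f) →
  eval f x ≡ eval f (suc x)
eval-suc ([]     , c ∷ [])  []          = refl
eval-suc (p ∷ ps , c ∷ cs) (x<p ∷ _) =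
  trans (upTo-≤ {g = eval (ps , cs)} (<⇒≤ x<p)) (sym (upTo-≤ {g = eval (ps , cs)} x<p))

-- A new piece starts exactly where `changes` holds; elsewhere Q-back carries the
-- value chosen at x + 1 back to x.
module _ {N : ℕ} {C : Set} (Q : ℕ → C → Set) (changes : ℕ → Bool)
         (Q-back : ∀ {x c} → changes x ≡ false → Q (suc x) c → Q x c) where

  fewChanges⇒stepCode : ∀ m a l {b} → a + l ≡ b → b < N → countFrom changes a l ≤ m →
    (∀ x → a ≤ x → x ≤ b → ∃ (Q x)) →
    ∃ λ (f : StepCode N C m) →
      VAll.All (λ p → a ≤ toℕ p) (proj₁ f) × (∀ x → a ≤ x → x ≤ b → Q x (eval f x))
  fewChanges⇒stepCode m a zero a+0≡b b<N _ label
    with trans (sym (+-identityʳ a)) a+0≡b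
  ... | refl with label a ≤-refl ≤-refl
  ... | c , Qac = constant p c , replicate⁺ m (≤-reflexive (sym (toℕ-fromℕ< b<N))) , tracks
    where
    p : Fin N
    p = fromℕ< b<N
    tracks : ∀ x → a ≤ x → x ≤ a → Q x (eval (constant {m = m} p c) x)
    tracks x a≤x x≤a rewrite eval-constant m p c x | ≤-antisym x≤a a≤x = Qac
  fewChanges⇒stepCode m a (suc l) a+l+1≡b b<N count label with changes a in changed
  fewChanges⇒stepCode m a (suc l) a+l+1≡b b<N count label | false
    with fewChanges⇒stepCode m (suc a) l (trans (sym (+-suc a l)) a+l+1≡b) b<N count
           (λ x a<x → label x (<⇒≤ a<x))
  ... | f , a<f , tracks = f , VAll.map <⇒≤ a<f , tracks′
    where
    tracks′ : ∀ x → a ≤ x → x ≤ _ → Q x (eval f x)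
    tracks′ x a≤x x≤b with m≤n⇒m<n∨m≡n a≤x
    ... | inj₁ a<x  = tracks x a<x x≤b
    ... | inj₂ refl = subst (Q a) (sym (eval-suc f a<f)) (Q-back changed
                        (tracks (suc a) ≤-refl (subst (a <_) a+l+1≡b (m<m+n a z<s))))
  fewChanges⇒stepCode zero    a (suc l) a+l+1≡b b<N ()          label | true
  fewChanges⇒stepCode (suc m) a (suc l) a+l+1≡b b<N (s≤s count) label | true
    with fewChanges⇒stepCode m (suc a) l (trans (sym (+-suc a l)) a+l+1≡b) b<N count
           (λ x a<x → label x (<⇒≤ a<x))
       | label a ≤-refl (subst (a ≤_) a+l+1≡b (m≤m+n a (suc l)))
  ... | f , a<f , tracks | c , Qac =
    cons a a<N c f , ≤-reflexive (sym (toℕ-fromℕ< a<N)) ∷ VAll.map <⇒≤ a<f ,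
    eval-cons-piecewise {Q = Q} a<N c f
      (λ x a≤x x≤a → subst (λ x → Q x c) (≤-antisym a≤x x≤a) Qac) tracks
    where
    a<N : a < N
    a<N = <-trans (subst (a <_) a+l+1≡b (m<m+n a z<s)) b<N

module _ {N : ℕ} {C : Set} (Q : ℕ → C → Set) (default : C) (χ : Coloring) where

  monoBlocks⇒stepCode : ∀ m ls st {b} → st + sum ls ≡ suc b → b < N → length ls ≤ m →
    MonoBlocks χ st ls →
    (∀ s e → st ≤ s → s ≤ e → e ≤ b → Monochromatic χ s e →
       ∃[ c ] ∀ x → s ≤ x → x ≤ e → Q x c) →
    ∃ λ (f : StepCode N C m) → ∀ x → st ≤ x → x ≤ b → Q x (eval f x)
  monoBlocks⇒stepCode m [] st st+0≡1+b b<N _ _ _ =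
    constant (fromℕ< b<N) default , λ x st≤x x≤b →
      ⊥-elim (<⇒≱ (s≤s x≤b)
                  (subst (_≤ x) (trans (sym (+-identityʳ st)) st+0≡1+b) st≤x))
  monoBlocks⇒stepCode zero    (_ ∷ _)      _ _ _ () _ _
  monoBlocks⇒stepCode (suc m) (zero ∷ _)   _ _ _ _  (() , _) _
  monoBlocks⇒stepCode (suc m) (suc l ∷ ls) st {b} eq b<N (s≤s len) (_ , mono , blocks) code =
    let (c , Qc) = code st (st + l) ≤-refl (m≤m+n st l) e≤b
                     (subst (Monochromatic χ st) (cong (_∸ 1) (+-suc st l)) mono)
        (f , tracks) = monoBlocks⇒stepCode m ls (st + suc l)
                         (trans (+-assoc st (suc l) (sum ls)) eq) b<N len blocks
                         (λ s e st′≤s → code s e (≤-trans (m≤m+n st (suc l)) st′≤s))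
    in cons (st + l) e<N c f ,
       eval-cons-piecewise {Q = Q} e<N c f Qc
         (λ x e<x → tracks x (subst (_≤ x) (sym (+-suc st l)) e<x))
    where
    e≤b : st + l ≤ b
    e≤b = ≤-pred (begin
      suc (st + l)          ≡⟨ +-suc st l ⟨
      st + suc l            ≤⟨ m≤m+n (st + suc l) (sum ls) ⟩
      st + suc l + sum ls   ≡⟨ +-assoc st (suc l) (sum ls) ⟩
      st + (suc l + sum ls) ≡⟨ eq ⟩
      suc b                 ∎)
      where open ≤-Reasoning
    e<N : st + l < N
    e<N = ≤-<-trans e≤b b<N

RowAgrees : Coloring → ℕ → ℕ → ℕ → (ℕ → Bool) → Set
RowAgrees χ n x e g = ∀ y → e < y → y ≤ n → χ x y ≡ g y

-- The block ending at e has colour `colour`; `rows` gives, as a step function of x,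
-- the row y ↦ χ x y on the columns after e.
BlockCode : ℕ → ℕ → Set
BlockCode N m = Fin N × Bool × StepCode N (StepCode N Bool m) m

decodeBlock : BlockCode N m → ℕ → ℕ → Bool
decodeBlock (e , colour , rows) x = upTo (toℕ e) colour (eval (eval rows x))

Code : ℕ → ℕ → Set
Code N m = StepCode N (BlockCode N m) m

decode : Code N m → Coloring
decode f x = decodeBlock (eval f x) x

module _ {m n : ℕ} {χ : Coloring}
  (al≤ : ∀ a b c d → IsInterval n a b → IsInterval n c d → b < c → AlBound m χ a b c d)
  (C≤  : ∀ a b c d → IsInterval n a b → IsInterval n c d → b < c → sizeC χ a b c d ≤ m)
  where

  rowsAfterBlock : ∀ {s e} → 1 ≤ s → s ≤ e → e ≤ n →
    ∃ λ (rows : StepCode (suc n) (StepCode (suc n) Bool m) m) →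
      ∀ x → s ≤ x → x ≤ e → RowAgrees χ n x e (eval (eval rows x))
  rowsAfterBlock {s} {e} 1≤s s≤e e≤n with e <? n
  ... | no e≮n = constant fzero (constant fzero false) ,
                 λ x _ _ y e<y y≤n → ⊥-elim (e≮n (<-≤-trans e<y y≤n))
  ... | yes e<n = Product.map₂ proj₂
        (fewChanges⇒stepCode (λ x r → RowAgrees χ n x e (eval r)) changes
           (λ {x} {r} → back {x} {r}) m s (e ∸ s) (m+[n∸m]≡n s≤e) (s≤s e≤n)
           (C≤ s e (suc e) n I J ≤-refl) row)
    where
    I : IsInterval n s e
    I = 1≤s , s≤e , e≤n
    J : IsInterval n (suc e) n
    J = s≤s z≤n , e<n , ≤-refl
    changes : ℕ → Bool
    changes x = anyFrom (λ y → χ x y xor χ (suc x) y) (suc e) (suc (n ∸ suc e))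
    back : ∀ {x} {r : StepCode (suc n) Bool m} → changes x ≡ false →
      RowAgrees χ n (suc x) e (eval r) → RowAgrees χ n x e (eval r)
    back same agrees y e<y y≤n =
      trans (xor≡false⇒≡ (anyFrom≡false _ _ _ same e<y y<end)) (agrees y e<y y≤n)
      where
      y<end : y < suc e + suc (n ∸ suc e)
      y<end = ≤-<-trans y≤n (subst (_< suc e + suc (n ∸ suc e)) (m+[n∸m]≡n e<n)
                                   (+-monoʳ-< (suc e) ≤-refl))
    row : ∀ x → s ≤ x → x ≤ e → ∃ λ r → RowAgrees χ n x e (eval r)
    row x s≤x x≤e = Product.map₂ proj₂
      (fewChanges⇒stepCode (λ y b → χ x y ≡ b) (λ y → χ x y xor χ x (suc y))
         (trans ∘ xor≡false⇒≡) m (suc e) (n ∸ suc e) (m+[n∸m]≡n e<n) ≤-refl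
         (≤-trans (n≤1+n _) (proj₁ (al≤ s e (suc e) n I J ≤-refl) x s≤x x≤e))
         (λ y _ _ → χ x y , refl))

  monochromatic⇒blockCode : ∀ {s e} → 1 ≤ s → s ≤ e → e ≤ n → Monochromatic χ s e →
    ∃ λ (c : BlockCode (suc n) m) →
      ∀ x → s ≤ x → x ≤ e → RowAgrees χ n x x (decodeBlock c x)
  monochromatic⇒blockCode {s} {e} 1≤s s≤e e≤n mono =
    -- χ s (suc s) is junk when s = e, but then the block has no pairs.
    let (rows , agrees) = rowsAfterBlock 1≤s s≤e e≤n
        colour = χ s (suc s)
    in (fromℕ< (s≤s e≤n) , colour , rows) , λ x s≤x x≤e y x<y y≤n →
         subst (λ e → χ x y ≡ upTo e colour (eval (eval rows x)) y)
               (sym (toℕ-fromℕ< (s≤s e≤n)))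
           (upTo-piecewise {Q = λ y b → χ x y ≡ b}
              (λ y x<y y≤e → mono x y s (suc s) s≤x x<y y≤e ≤-refl ≤-refl
                               (≤-trans (s≤s s≤x) (≤-trans x<y y≤e)))
              (agrees x s≤x x≤e) y x<y y≤n)

tame⇒code : ∀ {m n χ} → Tame m n χ →
  ∃ λ (c : Code (suc n) m) → SameColoring n χ (decode c)
tame⇒code {m} {n} {χ} ((ls , sum≡n , length≤m , blocks) , al≤ , C≤) =
  let (f , agrees) = monoBlocks⇒stepCode (λ x c → RowAgrees χ n x x (decodeBlock c x))
                       (fzero , false , constant fzero (constant fzero false)) χ
                       m ls 1 (cong suc sum≡n) ≤-refl length≤m blocks
                       (λ s e 1≤s → monochromatic⇒blockCode al≤ C≤ 1≤s)
  in f , λ x y 1≤x x<y y≤n → agrees x 1≤x (≤-trans (<⇒≤ x<y) y≤n) y x<y y≤n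

record Enumeration (N e : ℕ) (A : Set) : Set where
  field
    size       : ℕ
    size≤      : size ≤ N ^ e
    enumerate  : Fin size → A
    surjective : ∀ a → ∃[ i ] enumerate i ≡ a
open Enumeration

enum-Fin : ∀ N → Enumeration N 1 (Fin N)
enum-Fin N = record
  { size = N ; size≤ = ≤-reflexive (sym (*-identityʳ N))
  ; enumerate = λ i → i ; surjective = λ i → i , refl }

enum-Bool : 2 ≤ N → Enumeration N 1 Bool
enum-Bool {N = N} 2≤N = record
  { size = 2 ; size≤ = subst (2 ≤_) (sym (*-identityʳ N)) 2≤N
  ; enumerate = λ { fzero → false ; (fsuc _) → true }
  ; surjective = λ { false → fzero , refl ; true → fsuc fzero , refl } }

enum-map : (f : A → B) → (∀ b → ∃[ a ] f a ≡ b) →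
  Enumeration N e A → Enumeration N e B
enum-map f f-surjective E = record
  { size = size E ; size≤ = size≤ E ; enumerate = f ∘ enumerate E
  ; surjective = λ b → let (a , fa≡b) = f-surjective b ; (i , eᵢ≡a) = surjective E a
                       in i , trans (cong f eᵢ≡a) fa≡b }

enum-× : Enumeration N e₁ A → Enumeration N e₂ B → Enumeration N (e₁ + e₂) (A × B)
enum-× {N = N} {e₁ = e₁} {A = A} {e₂ = e₂} {B = B} EA EB = record
  { size = size EA * size EB
  ; size≤ = subst (size EA * size EB ≤_) (sym (^-distribˡ-+-* N e₁ e₂))
                  (*-mono-≤ (size≤ EA) (size≤ EB))
  ; enumerate = pair ∘ remQuot (size EB)
  ; surjective = λ (a , b) →
      let (i , eᵢ≡a) = surjective EA a ; (j , eⱼ≡b) = surjective EB b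
      in combine i j , trans (cong pair (remQuot-combine i j)) (cong₂ _,_ eᵢ≡a eⱼ≡b) }
  where
  pair : Fin (size EA) × Fin (size EB) → A × B
  pair = Product.map (enumerate EA) (enumerate EB)

enum-Vec : Enumeration N e A → ∀ k → Enumeration N (k * e) (Vec A k)
enum-Vec E zero = record
  { size = 1 ; size≤ = ≤-refl
  ; enumerate = λ _ → [] ; surjective = λ { [] → fzero , refl } }
enum-Vec E (suc k) =
  enum-map (uncurry _∷_) (λ { (a ∷ v) → (a , v) , refl }) (enum-× E (enum-Vec E k))

stepExp : ℕ → ℕ → ℕ
stepExp m e = m * 1 + suc m * e

codeExp : ℕ → ℕ
codeExp m = stepExp m (1 + (1 + stepExp m (stepExp m 1)))

enum-StepCode : Enumeration N e A → Enumeration N (stepExp m e) (StepCode N A m)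
enum-StepCode {N = N} {m = m} E = enum-× (enum-Vec (enum-Fin N) m) (enum-Vec E (suc m))

enum-Code : 2 ≤ N → Enumeration N (codeExp m) (Code N m)
enum-Code {N = N} 2≤N = enum-StepCode (enum-× (enum-Fin N)
  (enum-× (enum-Bool 2≤N) (enum-StepCode (enum-StepCode (enum-Bool 2≤N)))))

module _ {A : Set} {_≈_ : A → A → Set}
         (≈-sym : Symmetric _≈_) (≈-trans : Transitive _≈_) where

  pairwiseDistinct⇒length≤ : ∀ {S} (D : Fin S → A) {L} → All (λ a → ∃[ i ] a ≈ D i) L →
    AllPairs (λ a b → ¬ a ≈ b) L → length L ≤ S
  pairwiseDistinct⇒length≤ D [] [] = z≤n
  pairwiseDistinct⇒length≤ {zero} D ((() , _) ∷ _) _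
  pairwiseDistinct⇒length≤ {suc S} D {a ∷ _} ((i , a≈Dᵢ) ∷ covered) (a≉L ∷ distinct) =
    s≤s (pairwiseDistinct⇒length≤ (D ∘ punchIn i)
           (All.zipWith avoid (a≉L , covered)) distinct)
    where
    avoid : ∀ {b} → ¬ a ≈ b × ∃[ j ] b ≈ D j → ∃[ k ] b ≈ D (punchIn i k)
    avoid {b} (a≉b , j , b≈Dⱼ) =
      punchOut i≢j , subst (λ j → b ≈ D j) (sym (punchIn-punchOut i≢j)) b≈Dⱼ
      where
      i≢j : i ≡ j → _
      i≢j refl = a≉b (≈-trans a≈Dᵢ (≈-sym b≈Dⱼ))

sameColoring-sym : ∀ {n} → Symmetric (SameColoring n)
sameColoring-sym same x y 1≤x x<y y≤n = sym (same x y 1≤x x<y y≤n)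

sameColoring-trans : ∀ {n} → Transitive (SameColoring n)
sameColoring-trans same same′ x y 1≤x x<y y≤n =
  trans (same x y 1≤x x<y y≤n) (same′ x y 1≤x x<y y≤n)

sameColoring₁ : ∀ χ χ′ → SameColoring 1 χ χ′
sameColoring₁ _ _ x y 1≤x x<y y≤1 = ⊥-elim (<⇒≱ (<-≤-trans x<y y≤1) 1≤x)

distinctColorings≤ : ∀ {n S} (D : Fin S → Coloring) {L} →
  All (λ χ → ∃[ i ] SameColoring n χ (D i)) L →
  AllPairs (λ χ χ′ → ¬ SameColoring n χ χ′) L → length L ≤ S
distinctColorings≤ = pairwiseDistinct⇒length≤ sameColoring-sym sameColoring-trans

distinctTame≤ : ∀ {m n L} → 1 ≤ n → All (Tame m n) L →
  AllPairs (λ χ χ′ → ¬ SameColoring n χ χ′) L → length L ≤ suc n ^ codeExp m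
distinctTame≤ {m} {n} 1≤n tame distinct =
  ≤-trans (distinctColorings≤ (decode ∘ enumerate E) (All.map enumerated tame) distinct)
          (size≤ E)
  where
  E : Enumeration (suc n) (codeExp m) (Code (suc n) m)
  E = enum-Code (s≤s 1≤n)
  enumerated : ∀ {χ} → Tame m n χ → ∃[ i ] SameColoring n χ (decode (enumerate E i))
  enumerated t = let (c , same) = tame⇒code t ; (i , eᵢ≡c) = surjective E c
                 in i , subst (SameColoring n _ ∘ decode) (sym eᵢ≡c) same

n<n^2 : ∀ {n} → 1 < n → n < n ^ 2
n<n^2 {n@(suc _)} 1<n = subst (n <_) (cong (n *_) (sym (*-identityʳ n))) (m<m*n n n 1<n)

lemma3p14 : (m : ℕ) → Σ ℕ λ c → (n : ℕ) → 1 ≤ n →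
    (L : List Coloring) → All (Tame m n) L →
    AllPairs (λ χ χ' → ¬ SameColoring n χ χ') L →
    length L ≤ n ^ c
lemma3p14 m = 2 * codeExp m , bound
  where
  open ≤-Reasoning
  bound : (n : ℕ) → 1 ≤ n → (L : List Coloring) → All (Tame m n) L →
    AllPairs (λ χ χ' → ¬ SameColoring n χ χ') L → length L ≤ n ^ (2 * codeExp m)
  bound 1 _ L _ distinct = begin
    length L             ≤⟨ distinctColorings≤ (λ _ _ _ → false)
                              (All.universal (λ χ → fzero , sameColoring₁ χ _) L) distinct ⟩
    1                    ≡⟨ ^-zeroˡ (2 * codeExp m) ⟨
    1 ^ (2 * codeExp m)  ∎
  bound n@(suc (suc _)) 1≤n L tame distinct = begin
    length L             ≤⟨ distinctTame≤ 1≤n tame distinct ⟩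
    suc n ^ codeExp m    ≤⟨ ^-monoˡ-≤ (codeExp m) (n<n^2 (s≤s (s≤s z≤n))) ⟩
    (n ^ 2) ^ codeExp m  ≡⟨ ^-*-assoc n 2 (codeExp m) ⟩
    n ^ (2 * codeExp m)  ∎
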